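{- Let $T$ be a decomposition tree and $v$ an internal node of $T$ labeled $\oplus$, with left child $v_l$ and right child $v_r$. Then $\widehat{\min}(v)\ge\widehat{\min}(v_l)+\widehat{\min}(v_r)$.
   Context: All graphs are finite, simple and undirected. For a graph $H$ and $S\subseteq V(H)$, $N_H[S]$ is the closed neighbourhood of $S$ in $H$ and $H[S]$ the induced subgraph; a graph with no vertices is regarded as having a (empty) perfect matching. A decomposition tree is a rooted tree $T$ in which every internal node has exactly two children, a left child $v_l$ and a right child $v_r$, and carries one of the labels $\otimes$ (true twin), $\odot$ (false twin), $\oplus$ (attachment). To each node $v$ are associated a graph $\hat G(v)$ and a twin set $\hat{TS}(v)\subseteq V(\hat G(v))$: for a leaf, $\hat G(v)$ is a single vertex $x$ (distinct leaves giving distinct vertices) and $\hat{TS}(v)=\{x\}$; for an internal node $v$, $V(\hat G(v))=V(\hat G(v_l))\cup V(\hat G(v_r))$ and: if $v$ is labeled $\otimes$, $E(\hat G(v))=E(\hat G(v_l))\cup E(\hat G(v_r))\cup\{xy: x\in \hat{TS}(v_l), y\in\hat{TS}(v_r)\}$ and $\hat{TS}(v)=\hat{TS}(v_l)\cup\hat{TS}(v_r)$; if labeled $\odot$, $E(\hat G(v))=E(\hat G(v_l))\cup E(\hat G(v_r))$ and $\hat{TS}(v)=\hat{TS}(v_l)\cup\hat{TS}(v_r)$; if labeled $\oplus$, the edge set is as for $\otimes$ and $\hat{TS}(v)=\hat{TS}(v_l)$. For a node $u$ and $0\le k\le|\hat{TS}(u)|$, $\hat\gamma_k(u)$ is the minimum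 of $|S|$ over all $S\subseteq V(\hat G(u))$ with $V(\hat G(u))\setminus \hat{TS}(u)\subseteq N_{\hat G(u)}[S]$ for which there is $X\subseteq S\cap\hat{TS}(u)$, $|X|=k$, such that $\hat G(u)[S\setminus X]$ has a perfect matching. Let $\widehat{\min}(u)=\min\{\hat\gamma_k(u):0\le k\le|\hat{TS}(u)|\}$. -}

module Defs where

open import Data.Nat using (ℕ; zero; suc; _+_; _≤_)
open import Data.Bool using (Bool; true; false; _∧_; not; if_then_else_)
open import Data.Unit using (⊤; tt)
open import Data.Empty using (⊥)
open import Data.Sum using (_⊎_; inj₁; inj₂)
open import Data.Product using (Σ; ∃; _×_; _,_)
open import Data.List using (List; []; _∷_; _++_; map)
open import Data.Nat.ListAction using (sum)
open import Relation.Binary.PropositionalEquality using (_≡_)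

-- Node labels: ⊗ (true twin), ⊙ (false twin), ⊕ (attachment)
data Label : Set where
  ⊗ ⊙ ⊕ : Label

-- A decomposition tree: every internal node has exactly two children
-- (left, right) and a label.  A node of a tree is identified with the
-- subtree rooted at it.
data DTree : Set where
  leaf : DTree
  node : Label → DTree → DTree → DTree

-- Vertices of Ĝ(v): one vertex per leaf of the subtree (distinct leaves give
-- distinct vertices); V(Ĝ(v)) = V(Ĝ(v_l)) ∪ V(Ĝ(v_r)) (disjoint union).
Vtx : DTree → Set
Vtx leaf = ⊤
Vtx (node _ l r) = Vtx l ⊎ Vtx r

TS : (t : DTree) → Vtx t → Bool
TS leaf _ = true
TS (node ⊕ l r) (inj₁ x) = TS l x
TS (node ⊕ l r) (inj₂ y) = false
TS (node ⊗ l r) (inj₁ x) = TS l x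
TS (node ⊗ l r) (inj₂ y) = TS r y
TS (node ⊙ l r) (inj₁ x) = TS l x
TS (node ⊙ l r) (inj₂ y) = TS r y

Cross : Label → Bool → Bool → Set
Cross ⊙ _ _ = ⊥
Cross ⊗ a b = a ∧ b ≡ true
Cross ⊕ a b = a ∧ b ≡ true

Adj : (t : DTree) → Vtx t → Vtx t → Set
Adj leaf _ _ = ⊥
Adj (node c l r) (inj₁ x) (inj₁ y) = Adj l x y
Adj (node c l r) (inj₂ x) (inj₂ y) = Adj r x y
Adj (node c l r) (inj₁ x) (inj₂ y) = Cross c (TS l x) (TS r y)
Adj (node c l r) (inj₂ x) (inj₁ y) = Cross c (TS l y) (TS r x)

allV : (t : DTree) → List (Vtx t)
allV leaf = tt ∷ []
allV (node _ l r) = map inj₁ (allV l) ++ map inj₂ (allV r)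

Subset : DTree → Set
Subset t = Vtx t → Bool

card : (t : DTree) → Subset t → ℕ
card t S = sum (map (λ x → if S x then 1 else 0) (allV t))

_⊆_ : {t : DTree} → Subset t → Subset t → Set
_⊆_ {t} A B = (x : Vtx t) → A x ≡ true → B x ≡ true

Dominates : (t : DTree) → Subset t → Set
Dominates t S = (x : Vtx t) → TS t x ≡ false →
  Σ (Vtx t) (λ y → (S y ≡ true) × ((y ≡ x) ⊎ Adj t y x))

-- Ĝ(t)[W] has a perfect matching: there is a partner map pairing every
-- vertex of W with an adjacent vertex of W, involutively (so the edges
-- {x, m x} partition W; m x ≠ x since Ĝ(t) has no loops).
HasPerfectMatching : (t : DTree) → Subset t → Set
HasPerfectMatching t W = Σ (Vtx t → Vtx t) λ m →
  (x : Vtx t) → W x ≡ true →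
    (W (m x) ≡ true) × Adj t x (m x) × (m (m x) ≡ x)

FeasibleK : (t : DTree) → ℕ → Subset t → Set
FeasibleK t k S = Dominates t S × Σ (Subset t) λ X →
  (X ⊆ S) × (X ⊆ TS t) × (card t X ≡ k) ×
  HasPerfectMatching t (λ x → S x ∧ not (X x))

Feasible : (t : DTree) → Subset t → Set
Feasible t S = Σ ℕ λ k → (k ≤ card t (TS t)) × FeasibleK t k S

-- "min̂(t) ≤ s" is witnessed by an admissible set of size exactly s;
-- min̂(t) is the least such s (∞ if there is none).
Achieves : (t : DTree) → ℕ → Set
Achieves t s = Σ (Subset t) λ S → Feasible t S × (card t S ≡ s)

-- Restrict an admissible set S of Ĝ(v) to the two sides.  Every edge between
-- the sides joins a twin vertex of v_l to a twin vertex of v_r.  Hence a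
-- vertex outside the twin set is dominated from its own side, and a vertex
-- matched across can be moved into the excused set X of its side, which is
-- allowed precisely for twin vertices.  The two restrictions are admissible
-- and their sizes add up to |S|.  Nothing depends on the label of v.
module Submission where

open import Defs
open import Data.Nat using (ℕ; _+_; _≤_; z≤n)
open import Data.Nat.Properties using (≤-refl; ≤-reflexive; +-mono-≤)
open import Data.Nat.ListAction using (sum)
open import Data.Nat.ListAction.Properties using (sum-++)
open import Data.Bool using (Bool; true; false; _∧_; not; if_then_else_)
open import Data.Bool.Properties using (∧-conicalˡ; ∧-conicalʳ)
open import Data.Product using (Σ; _×_; _,_; proj₁; proj₂)
open import Data.Sum using (_⊎_; inj₁; inj₂; fromInj₁; fromInj₂)
open import Data.List using (List; []; _∷_; _++_; map)
open import Data.List.Properties using (map-++; map-∘)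
open import Function using (_∘_; const)
open import Relation.Nullary using (contradiction)
open import Relation.Binary.PropositionalEquality
  using (_≡_; _≗_; refl; sym; trans; cong; cong₂; module ≡-Reasoning)

_∖_ : {A : Set} → (A → Bool) → (A → Bool) → A → Bool
(P ∖ Q) x = P x ∧ not (Q x)

isLeft : {A B : Set} → A ⊎ B → Bool
isLeft (inj₁ _) = true
isLeft (inj₂ _) = false

isRight : {A B : Set} → A ⊎ B → Bool
isRight = not ∘ isLeft

a∧¬[a∧b]⇒¬b : ∀ a b → a ∧ not (a ∧ b) ≡ true → b ≡ false
a∧¬[a∧b]⇒¬b true false _ = refl

∧¬-split : ∀ s x m {τ} → (x ≡ true → τ ≡ true) →
  ((s ∧ not x) ∧ not m ≡ true → τ ≡ true) → s ∧ not m ≡ true → τ ≡ true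
∧¬-split s true m x⇒τ _ _ = x⇒τ refl
∧¬-split true false m _ w∖m⇒τ h = w∖m⇒τ h

s∧¬[s∧¬m]≡m : ∀ s m → (m ≡ true → s ≡ true) → s ∧ not (s ∧ not m) ≡ m
s∧¬[s∧¬m]≡m true true _ = refl
s∧¬[s∧¬m]≡m true false _ = refl
s∧¬[s∧¬m]≡m false false _ = refl
s∧¬[s∧¬m]≡m false true m⇒s with m⇒s refl
... | ()

card-node : (c : Label) (l r : DTree) (S : Subset (node c l r)) →
  card (node c l r) S ≡ card l (S ∘ inj₁) + card r (S ∘ inj₂)
card-node c l r S = begin
  sum (map χ (map inj₁ (allV l) ++ map inj₂ (allV r)))
    ≡⟨ cong sum (map-++ χ (map inj₁ (allV l)) (map inj₂ (allV r))) ⟩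
  sum (map χ (map inj₁ (allV l)) ++ map χ (map inj₂ (allV r)))
    ≡⟨ sum-++ (map χ (map inj₁ (allV l))) (map χ (map inj₂ (allV r))) ⟩
  sum (map χ (map inj₁ (allV l))) + sum (map χ (map inj₂ (allV r)))
    ≡⟨ sym (cong₂ _+_ (cong sum (map-∘ (allV l))) (cong sum (map-∘ (allV r)))) ⟩
  card l (S ∘ inj₁) + card r (S ∘ inj₂) ∎
  where
  open ≡-Reasoning
  χ : Vtx (node c l r) → ℕ
  χ x = if S x then 1 else 0

sum-indicator-mono : {A : Set} {P Q : A → Bool} → (∀ x → P x ≡ true → Q x ≡ true) →
  (xs : List A) →
  sum (map (λ x → if P x then 1 else 0) xs) ≤ sum (map (λ x → if Q x then 1 else 0) xs)
sum-indicator-mono P⊆Q [] = z≤n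
sum-indicator-mono {P = P} {Q} P⊆Q (x ∷ xs) =
  +-mono-≤ (indicator-mono (P x) (Q x) (P⊆Q x)) (sum-indicator-mono P⊆Q xs)
  where
  indicator-mono : ∀ p q → (p ≡ true → q ≡ true) → (if p then 1 else 0) ≤ (if q then 1 else 0)
  indicator-mono false q _ = z≤n
  indicator-mono true q p⇒q rewrite p⇒q refl = ≤-refl

card-mono : (t : DTree) {A B : Subset t} → _⊆_ {t} A B → card t A ≤ card t B
card-mono t A⊆B = sum-indicator-mono A⊆B (allV t)

TS-inj₁ : (c : Label) (l r : DTree) (x : Vtx l) → TS (node c l r) (inj₁ x) ≡ TS l x
TS-inj₁ ⊗ l r x = refl
TS-inj₁ ⊙ l r x = refl
TS-inj₁ ⊕ l r x = refl

TS-inj₂ : (c : Label) (l r : DTree) (y : Vtx r) → TS (node c l r) (inj₂ y) ≡ true → TS r y ≡ true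
TS-inj₂ ⊗ l r y h = h
TS-inj₂ ⊙ l r y h = h

non-TS-inj₂ : (c : Label) (l r : DTree) (y : Vtx r) →
  TS r y ≡ false → TS (node c l r) (inj₂ y) ≡ false
non-TS-inj₂ ⊗ l r y h = h
non-TS-inj₂ ⊙ l r y h = h
non-TS-inj₂ ⊕ l r y h = refl

Cross⇒TSˡ : (c : Label) {a b : Bool} → Cross c a b → a ≡ true
Cross⇒TSˡ ⊗ {a} {b} h = ∧-conicalˡ a b h
Cross⇒TSˡ ⊕ {a} {b} h = ∧-conicalˡ a b h

Cross⇒TSʳ : (c : Label) {a b : Bool} → Cross c a b → b ≡ true
Cross⇒TSʳ ⊗ {a} {b} h = ∧-conicalʳ a b h
Cross⇒TSʳ ⊕ {a} {b} h = ∧-conicalʳ a b h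

module _ (c : Label) (l r : DTree) (S : Subset (node c l r)) (dom : Dominates (node c l r) S) where

  dominatesˡ : Dominates l (S ∘ inj₁)
  dominatesˡ x x∉TS with dom (inj₁ x) (trans (TS-inj₁ c l r x) x∉TS)
  ... | inj₁ y , y∈S , inj₁ refl = y , y∈S , inj₁ refl
  ... | inj₁ y , y∈S , inj₂ adj = y , y∈S , inj₂ adj
  ... | inj₂ y , _ , inj₂ adj = contradiction (trans (sym (Cross⇒TSˡ c adj)) x∉TS) λ ()

  dominatesʳ : Dominates r (S ∘ inj₂)
  dominatesʳ y y∉TS with dom (inj₂ y) (non-TS-inj₂ c l r y y∉TS)
  ... | inj₂ z , z∈S , inj₁ refl = z , z∈S , inj₁ refl
  ... | inj₂ z , z∈S , inj₂ adj = z , z∈S , inj₂ adj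
  ... | inj₁ z , _ , inj₂ adj = contradiction (trans (sym (Cross⇒TSʳ c adj)) y∉TS) λ ()

matching-resp-≗ : (t : DTree) {A B : Subset t} → A ≗ B →
  HasPerfectMatching t A → HasPerfectMatching t B
matching-resp-≗ t A≗B (m , matches) = m , λ x Bx →
  let (Amx , adj , involutive) = matches x (trans (A≗B x) Bx)
  in trans (sym (A≗B (m x))) Amx , adj , involutive

PartneredIn : (t : DTree) → Subset t → (Vtx t → Vtx t) → Vtx t → Set
PartneredIn t W m x = (W (m x) ≡ true) × Adj t x (m x) × (m (m x) ≡ x)

module Restriction {c : Label} {l r : DTree} {W : Subset (node c l r)}
  (M : HasPerfectMatching (node c l r) W) where

  private
    partner = proj₁ M
    matches = proj₂ M

  Wˡ : Subset l
  Wˡ x = W (inj₁ x) ∧ isLeft (partner (inj₁ x))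

  Wʳ : Subset r
  Wʳ y = W (inj₂ y) ∧ isRight (partner (inj₂ y))

  Wˡ⊆W : _⊆_ {l} Wˡ (W ∘ inj₁)
  Wˡ⊆W x = ∧-conicalˡ (W (inj₁ x)) (isLeft (partner (inj₁ x)))

  Wʳ⊆W : _⊆_ {r} Wʳ (W ∘ inj₂)
  Wʳ⊆W y = ∧-conicalˡ (W (inj₂ y)) (isRight (partner (inj₂ y)))

  partnerˡ : Vtx l → Vtx l
  partnerˡ x = fromInj₁ (const x) (partner (inj₁ x))

  partnerʳ : Vtx r → Vtx r
  partnerʳ y = fromInj₂ (const y) (partner (inj₂ y))

  restrictˡ : HasPerfectMatching l Wˡ
  restrictˡ = partnerˡ , matchesˡ
    where
    matchesˡ : ∀ x → Wˡ x ≡ true → PartneredIn l Wˡ partnerˡ x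
    matchesˡ x h
      with partner (inj₁ x) | ∧-conicalʳ (W (inj₁ x)) (isLeft (partner (inj₁ x))) h
         | matches (inj₁ x) (∧-conicalˡ (W (inj₁ x)) (isLeft (partner (inj₁ x))) h)
    ... | inj₁ y | _ | Wy , adj , partner-y rewrite partner-y | Wy = refl , adj , refl
    ... | inj₂ _ | () | _

  restrictʳ : HasPerfectMatching r Wʳ
  restrictʳ = partnerʳ , matchesʳ
    where
    matchesʳ : ∀ y → Wʳ y ≡ true → PartneredIn r Wʳ partnerʳ y
    matchesʳ y h
      with partner (inj₂ y) | ∧-conicalʳ (W (inj₂ y)) (isRight (partner (inj₂ y))) h
         | matches (inj₂ y) (∧-conicalˡ (W (inj₂ y)) (isRight (partner (inj₂ y))) h)
    ... | inj₂ z | _ | Wz , adj , partner-z rewrite partner-z | Wz = refl , adj , refl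
    ... | inj₁ _ | () | _

  crossingˡ : _⊆_ {l} ((W ∘ inj₁) ∖ Wˡ) (TS l)
  crossingˡ x h
    with partner (inj₁ x) | a∧¬[a∧b]⇒¬b (W (inj₁ x)) (isLeft (partner (inj₁ x))) h
       | matches (inj₁ x) (∧-conicalˡ (W (inj₁ x)) (not (Wˡ x)) h)
  ... | inj₂ _ | _ | _ , adj , _ = Cross⇒TSˡ c adj
  ... | inj₁ _ | () | _

  crossingʳ : _⊆_ {r} ((W ∘ inj₂) ∖ Wʳ) (TS r)
  crossingʳ y h
    with partner (inj₂ y) | a∧¬[a∧b]⇒¬b (W (inj₂ y)) (isRight (partner (inj₂ y))) h
       | matches (inj₂ y) (∧-conicalˡ (W (inj₂ y)) (not (Wʳ y)) h)
  ... | inj₁ _ | _ | _ , adj , _ = Cross⇒TSʳ c adj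
  ... | inj₂ _ | () | _

achieves-card : (t : DTree) (S X M : Subset t) → Dominates t S → _⊆_ {t} X (TS t) →
  _⊆_ {t} M (S ∖ X) → _⊆_ {t} ((S ∖ X) ∖ M) (TS t) → HasPerfectMatching t M →
  Achieves t (card t S)
achieves-card t S X M dom X⊆TS M⊆S∖X S∖X∖M⊆TS matching =
  S , (card t X′ , card-mono t X′⊆TS , dom , X′ , X′⊆S , X′⊆TS , refl , matching′) , refl
  where
  X′ : Subset t
  X′ = S ∖ M

  X′⊆S : _⊆_ {t} X′ S
  X′⊆S x = ∧-conicalˡ (S x) (not (M x))

  X′⊆TS : _⊆_ {t} X′ (TS t)
  X′⊆TS x = ∧¬-split (S x) (X x) (M x) (X⊆TS x) (S∖X∖M⊆TS x)

  matching′ : HasPerfectMatching t (S ∖ X′)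
  matching′ = matching-resp-≗ t
    (λ x → sym (s∧¬[s∧¬m]≡m (S x) (M x) (∧-conicalˡ (S x) (not (X x)) ∘ M⊆S∖X x)))
    matching

module _ {c : Label} {l r : DTree} {S : Subset (node c l r)} where

  achievesˡ : Feasible (node c l r) S → Achieves l (card l (S ∘ inj₁))
  achievesˡ (_ , _ , dom , X , _ , X⊆TS , _ , M) =
    achieves-card l (S ∘ inj₁) (X ∘ inj₁) Wˡ (dominatesˡ c l r S dom)
      (λ x h → trans (sym (TS-inj₁ c l r x)) (X⊆TS (inj₁ x) h))
      Wˡ⊆W crossingˡ restrictˡ
    where open Restriction M

  achievesʳ : Feasible (node c l r) S → Achieves r (card r (S ∘ inj₂))
  achievesʳ (_ , _ , dom , X , _ , X⊆TS , _ , M) =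
    achieves-card r (S ∘ inj₂) (X ∘ inj₂) Wʳ (dominatesʳ c l r S dom)
      (λ y h → TS-inj₂ c l r y (X⊆TS (inj₂ y) h))
      Wʳ⊆W crossingʳ restrictʳ
    where open Restriction M

lemma28 : (l r : DTree) (s : ℕ) → Achieves (node ⊕ l r) s →
    Σ ℕ λ sl → Σ ℕ λ sr → Achieves l sl × Achieves r sr × (sl + sr ≤ s)
lemma28 l r s (S , feasible , |S|≡s) =
  card l (S ∘ inj₁) , card r (S ∘ inj₂) , achievesˡ feasible , achievesʳ feasible ,
  ≤-reflexive (trans (sym (card-node ⊕ l r S)) |S|≡s)
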